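{- Let $P_n$ be the path graph with vertex set $\{1,\dots,n\}$ and edges $\{i,i+1\}$ for $1\le i<n$, and let $f_0$ be a configuration on $P_n$. Run the following algorithm: set $j=0$; while $f_j$ is not the identity, increase $j$ by one, let $S_j=\{\{i,i+1\}\mid 1\le i<n,\ f_{j-1}(i)>f_{j-1}(i+1),\ i+j \text{ even}\}$ and $f_j=f_{j-1}S_j$; finally output $\mathsf{AP}(P_n,f_0)=\langle S_1,\dots,S_j\rangle$. Then the output sequence has length $|\mathsf{AP}(P_n,f_0)|\le \mathsf{rt}(P_n,f_0)+1$.
   Context: A configuration on a graph $G=(V,E)$ is a bijection $f:V\to V$ ($f(u)$ is the token on vertex $u$); here the tokens are the integers $1,\dots,n$, compared in the usual order. A parallel swap is a matching $S\subseteq E$; $fS(u)=f(v)$ if $\{u,v\}\in S$ and $fS(u)=f(u)$ if $u$ is covered by no edge of $S$; sequences are applied left to right. $\mathsf{rt}(G,f)$ is the minimum $m$ such that there are parallel swaps $S_1,\dots,S_m$ with $f\langle S_1,\dots,S_m\rangle$ equal to the identity map. -}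

module Defs where

open import Data.Nat using (ℕ; zero; suc; _+_; _<_; _≤_; _<ᵇ_; _<?_)
open import Data.Nat.Properties using (<-trans; n<1+n)
open import Data.Fin using (Fin; toℕ; fromℕ<; inject₁)
open import Data.Bool using (Bool; true; false; _∧_; if_then_else_)
open import Data.List using (List; []; _∷_; length)
open import Data.List.Relation.Unary.All using (All)
open import Data.Product using (∃; _×_; _,_)
open import Relation.Nullary using (¬_; yes; no)
open import Relation.Binary.PropositionalEquality using (_≡_)
open import Function.Definitions using (Bijective)

-- Conventions (0-based): the vertex i of P_n (1 ≤ i ≤ n) is the element
-- i - 1 of Fin n, and the token t ∈ {1,…,n} is the element t - 1 of Fin n
-- (this preserves the usual order of tokens).

Config : ℕ → Set
Config n = Fin n → Fin n

IsConfig : ∀ {n} → Config n → Set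
IsConfig f = Bijective _≡_ _≡_ f

-- A set of edges of P_n is given by its indicator s on left endpoints:
-- s i ≡ true means the edge {i, i+1} belongs to the set.
EdgeSet : Set
EdgeSet = ℕ → Bool

IsMatching : ℕ → EdgeSet → Set
IsMatching n s =
  (∀ i → s i ≡ true → suc i < n) × (∀ i → s i ≡ true → s (suc i) ≡ false)

-- The vertex matched to u by s (u itself if u is uncovered).
partner : ∀ {n} → EdgeSet → Fin n → Fin n
partner {n} s u with s (toℕ u) | suc (toℕ u) <? n
... | true | yes p = fromℕ< p
... | _    | _     = left u
  where
  left : ∀ {m} → Fin m → Fin m
  left Fin.zero    = Fin.zero
  left (Fin.suc k) = if s (toℕ k) then inject₁ k else Fin.suc k

_⟪_⟫ : ∀ {n} → Config n → EdgeSet → Config n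
(f ⟪ s ⟫) u = f (partner s u)

applyAll : ∀ {n} → Config n → List EdgeSet → Config n
applyAll f []       = f
applyAll f (s ∷ ss) = applyAll (f ⟪ s ⟫) ss

IsId : ∀ {n} → Config n → Set
IsId f = ∀ u → f u ≡ u

SortableIn : ∀ {n} → Config n → ℕ → Set
SortableIn {n} f m =
  ∃ λ (ss : List EdgeSet) → length ss ≡ m × All (IsMatching n) ss × IsId (applyAll f ss)

IsRt : ∀ {n} → Config n → ℕ → Set
IsRt f r = SortableIn f r × (∀ m → SortableIn f m → r ≤ m)

even : ℕ → Bool
even zero          = true
even (suc zero)    = false
even (suc (suc k)) = even k

-- S_j for the configuration g = f_{j-1}: the 0-based edge {i, i+1}
-- (1-based {i+1, i+2}) is selected iff g(i) > g(i+1) and (i+1)+j is even.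
selectAP : ∀ {n} → Config n → ℕ → EdgeSet
selectAP {n} g j i with suc i <? n
... | yes p = (toℕ (g (fromℕ< p)) <ᵇ toℕ (g (fromℕ< (<-trans (n<1+n i) p))))
              ∧ even (suc i + j)
... | no _  = false

-- f_j in the algorithm AP (iterated regardless of the stopping test).
apConf : ∀ {n} → Config n → ℕ → Config n
apConf f zero    = f
apConf f (suc j) = apConf f j ⟪ selectAP (apConf f j) (suc j) ⟫

APLength : ∀ {n} → Config n → ℕ → Set
APLength f L = IsId (apConf f L) × (∀ j → j < L → ¬ IsId (apConf f j))

{-# OPTIONS --safe #-}
module Submission where

-- By the 0-1 principle it suffices to follow, for every threshold θ, the 0-1 word i ↦ [θ ≤ g(i)] of a
-- configuration g: g is the identity iff all these words are sorted.  Compare, by the number of ones in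
-- every suffix, the words of a sorting sequence of r parallel swaps after t swaps with those of the
-- algorithm after t rounds.  The algorithm is never behind, except possibly by one 1 waiting at the left
-- end of an edge that its next round activates.  This is preserved because a parallel swap moves every 1
-- by at most one position while a round moves the larger bit of each active edge to its right end, and
-- one more round removes the exception.  After r + 1 rounds the algorithm's words therefore dominate the
-- sorted words with the same number of ones, which forces them to be sorted.

open import Defs
open import Data.Bool using (Bool; true; false; _∧_; _∨_; not; if_then_else_; T)
open import Data.Bool.Properties using (∧-zeroʳ; ∧-identityʳ; ∧-conicalˡ; ∧-conicalʳ; ∨-identityʳ; ∨-zeroʳ; T-≡)
open import Data.Empty using (⊥-elim)
open import Data.Fin using (Fin; toℕ; fromℕ<)
open import Data.Fin.Properties using (toℕ-fromℕ<; fromℕ<-toℕ; toℕ-injective; toℕ<n; toℕ-inject₁; all?) renaming (_≟_ to _≟ᶠ_)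
open import Data.List using ([]; _∷_; length)
open import Data.List.Relation.Unary.All using (All; []; _∷_)
open import Data.Nat using (ℕ; zero; suc; pred; _+_; _∸_; _⊔_; _⊓_; _≤_; _<_; z≤n; s≤s; s≤s⁻¹; _≤ᵇ_; _<ᵇ_; _<?_; _≤?_)
open import Data.Nat.Properties
open import Algebra.Properties.CommutativeSemigroup +-commutativeSemigroup using (x∙yz≈y∙xz)
open import Data.Product using (∃; _×_; _,_; proj₁; proj₂)
open import Data.Sum using (_⊎_; inj₁; inj₂; [_,_]′)
open import Data.Unit using (⊤; tt)
open import Function using (_∘_)
open import Function.Bundles using (module Equivalence)
open import Relation.Binary.PropositionalEquality
open import Relation.Nullary using (¬_; yes; no; Dec)

≤⇒≤ᵇ≡true : ∀ {m n} → m ≤ n → (m ≤ᵇ n) ≡ true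
≤⇒≤ᵇ≡true = Equivalence.to T-≡ ∘ ≤⇒≤ᵇ

≤ᵇ≡true⇒≤ : ∀ {m n} → (m ≤ᵇ n) ≡ true → m ≤ n
≤ᵇ≡true⇒≤ = ≤ᵇ⇒≤ _ _ ∘ Equivalence.from T-≡

<⇒<ᵇ≡true : ∀ {m n} → m < n → (m <ᵇ n) ≡ true
<⇒<ᵇ≡true = Equivalence.to T-≡ ∘ <⇒<ᵇ

<ᵇ≡true⇒< : ∀ {m n} → (m <ᵇ n) ≡ true → m < n
<ᵇ≡true⇒< = <ᵇ⇒< _ _ ∘ Equivalence.from T-≡

≤ᵇ-injective : ∀ {a b} → (∀ θ → (θ ≤ᵇ a) ≡ (θ ≤ᵇ b)) → a ≡ b
≤ᵇ-injective {a} {b} same = ≤-antisym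
  (≤ᵇ≡true⇒≤ (trans (sym (same a)) (≤⇒≤ᵇ≡true (≤-refl {a}))))
  (≤ᵇ≡true⇒≤ (trans (same b) (≤⇒≤ᵇ≡true (≤-refl {b}))))

even≡not-even-suc : ∀ m → even m ≡ not (even (suc m))
even≡not-even-suc zero          = refl
even≡not-even-suc (suc zero)    = refl
even≡not-even-suc (suc (suc m)) = even≡not-even-suc m

bit : Bool → ℕ
bit false = 0
bit true  = 1

bit≤1 : ∀ b → bit b ≤ 1
bit≤1 false = z≤n
bit≤1 true  = s≤s z≤n

bit-injective : ∀ {a b} → bit a ≡ bit b → a ≡ b
bit-injective {false} {false} _ = refl
bit-injective {true}  {true}  _ = refl

[x⇒y]⇒x∨y≡y : ∀ {a b} → (a ≡ true → b ≡ true) → a ∨ b ≡ b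
[x⇒y]⇒x∨y≡y {false} _   = refl
[x⇒y]⇒x∨y≡y {true}  a⇒b = sym (a⇒b refl)

[y⇒x]⇒x∨y≡x : ∀ {a b} → (b ≡ true → a ≡ true) → a ∨ b ≡ a
[y⇒x]⇒x∨y≡x {a} {false} _   = ∨-identityʳ a
[y⇒x]⇒x∨y≡x {a} {true}  b⇒a = trans (∨-zeroʳ a) (sym (b⇒a refl))

true≢false : true ≢ false
true≢false ()

Least : (ℕ → Set) → ℕ → Set
Least P L = P L × (∀ j → j < L → ¬ P j)

least-below : ∀ {P : ℕ → Set} → (∀ j → Dec (P j)) →
              ∀ N → (∀ j → j < N → ¬ P j) ⊎ ∃ λ L → Least P L × L < N
least-below P? zero = inj₁ (λ _ ())
least-below P? (suc N) with least-below P? N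
... | inj₂ (L , least , L<N) = inj₂ (L , least , m<n⇒m<1+n L<N)
... | inj₁ none with P? N
...   | yes pN = inj₂ (N , (pN , none) , n<1+n N)
...   | no ¬pN = inj₁ λ j j<1+N → [ none j , (λ { refl → ¬pN }) ]′ (m<1+n⇒m<n∨m≡n j<1+N)

least-≤ : ∀ {P : ℕ → Set} → (∀ j → Dec (P j)) → ∀ N → P N → ∃ λ L → Least P L × L ≤ N
least-≤ P? N pN with least-below P? (suc N)
... | inj₁ none = ⊥-elim (none N (n<1+n N) pN)
... | inj₂ (L , least , L<1+N) = L , least , s≤s⁻¹ L<1+N

ones : (ℕ → Bool) → ℕ → ℕ → ℕ
ones x q zero    = 0
ones x q (suc d) = bit (x q) + ones x (suc q) d

ones≤ : ∀ x q d → ones x q d ≤ d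
ones≤ x q zero    = z≤n
ones≤ x q (suc d) = +-mono-≤ (bit≤1 (x q)) (ones≤ x (suc q) d)

ones-cong : ∀ {x y} → x ≗ y → ∀ q d → ones x q d ≡ ones y q d
ones-cong x≗y q zero    = refl
ones-cong x≗y q (suc d) = cong₂ _+_ (cong bit (x≗y q)) (ones-cong x≗y (suc q) d)

LeftFree : EdgeSet → ℕ → Set
LeftFree s zero    = ⊤
LeftFree s (suc p) = s p ≡ false

mate : EdgeSet → ℕ → ℕ
mate s zero    = if s zero then 1 else zero
mate s (suc p) = if s (suc p) then suc (suc p) else (if s p then p else suc p)

mate-right : ∀ s {i} → s i ≡ true → mate s i ≡ suc i
mate-right s {zero}  sᵢ rewrite sᵢ = refl
mate-right s {suc p} sᵢ rewrite sᵢ = refl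

mate-left : ∀ s {p} → s p ≡ true → s (suc p) ≡ false → mate s (suc p) ≡ p
mate-left s sₚ sₚ₊₁ rewrite sₚ₊₁ | sₚ = refl

mate-free : ∀ s {i} → s i ≡ false → LeftFree s i → mate s i ≡ i
mate-free s {zero}  sᵢ _    rewrite sᵢ = refl
mate-free s {suc p} sᵢ free rewrite sᵢ | free = refl

module _ (n : ℕ) where

  onesFrom : (ℕ → Bool) → ℕ → ℕ
  onesFrom x q = ones x q (n ∸ q)

  onesFrom-unfold : ∀ x {q} → q < n → onesFrom x q ≡ bit (x q) + onesFrom x (suc q)
  onesFrom-unfold x q<n rewrite +-∸-assoc 1 q<n = refl

  onesFrom-beyond : ∀ x {q} → n ≤ q → onesFrom x q ≡ 0
  onesFrom-beyond x n≤q rewrite m≤n⇒m∸n≡0 n≤q = refl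

  onesFrom-cong : ∀ {x y} → x ≗ y → ∀ q → onesFrom x q ≡ onesFrom y q
  onesFrom-cong x≗y q = ones-cong x≗y q (n ∸ q)

  onesFrom-suc-≤ : ∀ x q → onesFrom x (suc q) ≤ onesFrom x q
  onesFrom-suc-≤ x q with q <? n
  ... | yes q<n = ≤-trans (m≤n+m _ _) (≤-reflexive (sym (onesFrom-unfold x q<n)))
  ... | no  q≮n = ≤-trans (≤-reflexive (onesFrom-beyond x (m≤n⇒m≤1+n (≮⇒≥ q≮n)))) z≤n

  onesFrom-≤-suc : ∀ x q → onesFrom x q ≤ suc (onesFrom x (suc q))
  onesFrom-≤-suc x q with q <? n
  ... | yes q<n = ≤-trans (≤-reflexive (onesFrom-unfold x q<n)) (+-monoˡ-≤ _ (bit≤1 (x q)))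
  ... | no  q≮n = ≤-trans (≤-reflexive (onesFrom-beyond x (≮⇒≥ q≮n))) z≤n

  onesFrom≤onesFrom₀ : ∀ x q → onesFrom x q ≤ onesFrom x 0
  onesFrom≤onesFrom₀ x zero    = ≤-refl
  onesFrom≤onesFrom₀ x (suc q) = ≤-trans (onesFrom-suc-≤ x q) (onesFrom≤onesFrom₀ x q)

  onesFrom-injective : ∀ {x y} → (∀ q → onesFrom x q ≡ onesFrom y q) → ∀ {i} → i < n → x i ≡ y i
  onesFrom-injective {x} {y} same {i} i<n = bit-injective (+-cancelʳ-≡ _ _ _ (begin
    bit (x i) + onesFrom x (suc i) ≡⟨ sym (onesFrom-unfold x i<n) ⟩
    onesFrom x i                   ≡⟨ same i ⟩
    onesFrom y i                   ≡⟨ onesFrom-unfold y i<n ⟩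
    bit (y i) + onesFrom y (suc i) ≡⟨ cong (bit (y i) +_) (sym (same (suc i))) ⟩
    bit (y i) + onesFrom x (suc i) ∎))
    where open ≡-Reasoning

  threshold-step : ∀ θ {q} → q < n → bit (θ ≤ᵇ q) + (n ∸ (θ ⊔ suc q)) ≡ n ∸ (θ ⊔ q)
  threshold-step θ {q} q<n with θ ≤ᵇ q in θ≤ᵇq
  ... | true = begin
      suc (n ∸ (θ ⊔ suc q)) ≡⟨ cong (λ m → suc (n ∸ m)) (m≤n⇒m⊔n≡n (m≤n⇒m≤1+n θ≤q)) ⟩
      suc (n ∸ suc q)       ≡⟨ sym (+-∸-assoc 1 q<n) ⟩
      n ∸ q                 ≡⟨ cong (n ∸_) (sym (m≤n⇒m⊔n≡n θ≤q)) ⟩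
      n ∸ (θ ⊔ q)           ∎
    where
    open ≡-Reasoning
    θ≤q : θ ≤ q
    θ≤q = ≤ᵇ≡true⇒≤ θ≤ᵇq
  ... | false = cong (n ∸_) (trans (m≥n⇒m⊔n≡m q<θ) (sym (m≥n⇒m⊔n≡m (<⇒≤ q<θ))))
    where
    q<θ : q < θ
    q<θ = ≰⇒> (λ θ≤q → subst T θ≤ᵇq (≤⇒≤ᵇ θ≤q))

  ones-threshold : ∀ {x} θ → (∀ {i} → i < n → x i ≡ (θ ≤ᵇ i)) →
                   ∀ d q → q + d ≡ n → ones x q d ≡ n ∸ (θ ⊔ q)
  ones-threshold θ xᵢ zero q q+0≡n =
    sym (m≤n⇒m∸n≡0 (≤-trans (≤-reflexive (trans (sym q+0≡n) (+-identityʳ q))) (m≤n⊔m θ q)))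
  ones-threshold θ xᵢ (suc d) q q+d≡n =
    trans (cong₂ _+_ (cong bit (xᵢ q<n)) (ones-threshold θ xᵢ d (suc q) q+1+d≡n)) (threshold-step θ q<n)
    where
    q+1+d≡n : suc q + d ≡ n
    q+1+d≡n = trans (sym (+-suc q d)) q+d≡n
    q<n : q < n
    q<n = ≤-trans (s≤s (m≤m+n q d)) (≤-reflexive q+1+d≡n)

  onesFrom-threshold : ∀ {x} θ → (∀ {i} → i < n → x i ≡ (θ ≤ᵇ i)) → ∀ q → onesFrom x q ≡ n ∸ (θ ⊔ q)
  onesFrom-threshold {x} θ xᵢ q with q ≤? n
  ... | yes q≤n = ones-threshold θ xᵢ (n ∸ q) q (m+[n∸m]≡n q≤n)
  ... | no  q≰n = trans (onesFrom-beyond x n≤q) (sym (m≤n⇒m∸n≡0 (≤-trans n≤q (m≤n⊔m θ q))))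
    where
    n≤q : n ≤ q
    n≤q = <⇒≤ (≰⇒> q≰n)

  -- Among words with the same number of ones, the sorted one has the most ones in every suffix.
  dominated-sorted-word : ∀ {x w} θ → (∀ {i} → i < n → x i ≡ (θ ≤ᵇ i)) →
    (∀ q → onesFrom x q ≤ onesFrom w q) → onesFrom w 0 ≡ onesFrom x 0 → ∀ {i} → i < n → w i ≡ x i
  dominated-sorted-word {x} {w} θ xᵢ x≤w total = onesFrom-injective λ q → ≤-antisym (begin
      onesFrom w q                 ≤⟨ ⊓-glb (≤-trans (onesFrom≤onesFrom₀ w q) (≤-reflexive total)) (ones≤ w q (n ∸ q)) ⟩
      onesFrom x 0 ⊓ (n ∸ q)       ≡⟨ cong (_⊓ (n ∸ q)) (onesFrom-threshold θ xᵢ 0) ⟩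
      (n ∸ (θ ⊔ 0)) ⊓ (n ∸ q)      ≡⟨ cong (λ m → (n ∸ m) ⊓ (n ∸ q)) (⊔-identityʳ θ) ⟩
      (n ∸ θ) ⊓ (n ∸ q)            ≡⟨ sym (∸-distribˡ-⊔-⊓ n θ q) ⟩
      n ∸ (θ ⊔ q)                  ≡⟨ sym (onesFrom-threshold θ xᵢ q) ⟩
      onesFrom x q                 ∎) (x≤w q)
    where open ≤-Reasoning

  record MovesAtMostOne (x x′ : ℕ → Bool) : Set where
    field
      from-pred : ∀ q → onesFrom x′ q ≤ onesFrom x (pred q)
      from-suc  : ∀ q → onesFrom x′ q ≤ suc (onesFrom x (suc q))

  moves-refl : ∀ x → MovesAtMostOne x x
  moves-refl x = record { from-pred = from-pred ; from-suc = onesFrom-≤-suc x }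
    where
    from-pred : ∀ q → onesFrom x q ≤ onesFrom x (pred q)
    from-pred zero    = ≤-refl
    from-pred (suc q) = onesFrom-suc-≤ x q

  module _ {s : EdgeSet} (M : IsMatching n s) where

    unselected-beyond : ∀ {i} → n ≤ suc i → s i ≡ false
    unselected-beyond {i} n≤1+i with s i in sᵢ
    ... | true  = ⊥-elim (<⇒≱ (proj₁ M i sᵢ) n≤1+i)
    ... | false = refl

    selected⇒left-free : ∀ {i} → s i ≡ true → LeftFree s i
    selected⇒left-free {zero}  _  = tt
    selected⇒left-free {suc p} sᵢ with s p in sₚ
    ... | true  = ⊥-elim (true≢false (trans (sym sᵢ) (proj₂ M p sₚ)))
    ... | false = refl

    mate-beyond : ∀ {i} → n ≤ i → mate s i ≡ i
    mate-beyond {zero}  n≤i = mate-free s (unselected-beyond (m≤n⇒m≤1+n n≤i)) tt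
    mate-beyond {suc p} n≤i = mate-free s (unselected-beyond (m≤n⇒m≤1+n n≤i)) (unselected-beyond n≤i)

    mate-selected : ∀ {p} → s p ≡ true → mate s (suc p) ≡ p
    mate-selected sₚ = mate-left s sₚ (proj₂ M _ sₚ)

    ones-swap : ∀ x d q → q + d ≡ n → LeftFree s q → ones (x ∘ mate s) q d ≡ ones x q d
    ones-swap x zero    q _     _    = refl
    ones-swap x (suc d) q q+d≡n free with s q in sq
    ... | false = cong₂ _+_ (cong (bit ∘ x) (mate-free s sq free))
                            (ones-swap x d (suc q) (trans (sym (+-suc q d)) q+d≡n) sq)
    ... | true with d
    ...   | zero   = ⊥-elim (<-irrefl (trans (+-comm 1 q) q+d≡n) (proj₁ M q sq))
    ...   | suc d′ = begin
        bit (x (mate s q)) + (bit (x (mate s (suc q))) + ones (x ∘ mate s) (suc (suc q)) d′)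
          ≡⟨ cong₂ (λ a b → bit (x a) + (bit (x b) + ones (x ∘ mate s) (suc (suc q)) d′))
                   (mate-right s sq) (mate-selected sq) ⟩
        bit (x (suc q)) + (bit (x q) + ones (x ∘ mate s) (suc (suc q)) d′)
          ≡⟨ cong (λ m → bit (x (suc q)) + (bit (x q) + m)) rest ⟩
        bit (x (suc q)) + (bit (x q) + ones x (suc (suc q)) d′)
          ≡⟨ x∙yz≈y∙xz (bit (x (suc q))) (bit (x q)) _ ⟩
        bit (x q) + (bit (x (suc q)) + ones x (suc (suc q)) d′) ∎
      where
      open ≡-Reasoning
      rest : ones (x ∘ mate s) (suc (suc q)) d′ ≡ ones x (suc (suc q)) d′
      rest = ones-swap x d′ (suc (suc q)) (trans (sym (trans (+-suc q (suc d′)) (cong suc (+-suc q d′)))) q+d≡n)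
                       (proj₂ M q sq)

    onesFrom-swap : ∀ x {q} → LeftFree s q → onesFrom (x ∘ mate s) q ≡ onesFrom x q
    onesFrom-swap x {q} free with q ≤? n
    ... | yes q≤n = ones-swap x (n ∸ q) q (m+[n∸m]≡n q≤n) free
    ... | no  q≰n = trans (onesFrom-beyond (x ∘ mate s) n≤q) (sym (onesFrom-beyond x n≤q))
      where
      n≤q : n ≤ q
      n≤q = <⇒≤ (≰⇒> q≰n)

    onesFrom-swap-selected : ∀ x {p} → s p ≡ true →
                             onesFrom (x ∘ mate s) (suc p) ≡ bit (x p) + onesFrom x (suc (suc p))
    onesFrom-swap-selected x {p} sₚ = begin
      onesFrom (x ∘ mate s) (suc p)
        ≡⟨ onesFrom-unfold (x ∘ mate s) (proj₁ M p sₚ) ⟩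
      bit (x (mate s (suc p))) + onesFrom (x ∘ mate s) (suc (suc p))
        ≡⟨ cong₂ _+_ (cong (bit ∘ x) (mate-selected sₚ)) (onesFrom-swap x (proj₂ M p sₚ)) ⟩
      bit (x p) + onesFrom x (suc (suc p))
        ∎
      where open ≡-Reasoning

    moves-swap : ∀ x → MovesAtMostOne x (x ∘ mate s)
    moves-swap x = record { from-pred = from-pred ; from-suc = from-suc }
      where
      from-pred : ∀ q → onesFrom (x ∘ mate s) q ≤ onesFrom x (pred q)
      from-pred zero = ≤-reflexive (onesFrom-swap x tt)
      from-pred (suc p) with s p in sₚ
      ... | true = begin
        onesFrom (x ∘ mate s) (suc p)         ≡⟨ onesFrom-swap-selected x sₚ ⟩
        bit (x p) + onesFrom x (suc (suc p))  ≤⟨ +-monoʳ-≤ (bit (x p)) (onesFrom-suc-≤ x (suc p)) ⟩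
        bit (x p) + onesFrom x (suc p)        ≡⟨ sym (onesFrom-unfold x (<-trans (n<1+n p) (proj₁ M p sₚ))) ⟩
        onesFrom x p                          ∎
        where open ≤-Reasoning
      ... | false = ≤-trans (≤-reflexive (onesFrom-swap x sₚ)) (onesFrom-suc-≤ x p)
      from-suc : ∀ q → onesFrom (x ∘ mate s) q ≤ suc (onesFrom x (suc q))
      from-suc q with s q in sq
      ... | true  = ≤-trans (≤-reflexive (onesFrom-swap x (selected⇒left-free sq))) (onesFrom-≤-suc x q)
      ... | false = ≤-trans (onesFrom-≤-suc (x ∘ mate s) q) (s≤s (≤-reflexive (onesFrom-swap x sq)))

  -- Rounds of the algorithm on 0-1 words

  active : ℕ → ℕ → Bool
  active j p = (suc p <ᵇ n) ∧ even (suc p + j)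

  active⇒edge : ∀ {j p} → active j p ≡ true → suc p < n
  active⇒edge a = <ᵇ≡true⇒< (∧-conicalˡ _ _ a)

  active⇒inactive-suc : ∀ {j p} → active j p ≡ true → active j (suc p) ≡ false
  active⇒inactive-suc {j} {p} a =
    trans (cong ((suc (suc p) <ᵇ n) ∧_) (trans (even≡not-even-suc (p + j)) (cong not (∧-conicalʳ _ _ a))))
          (∧-zeroʳ _)

  active-suc⇒inactive : ∀ {j p} → active j (suc p) ≡ true → active j p ≡ false
  active-suc⇒inactive {j} {p} a =
    trans (cong ((suc p <ᵇ n) ∧_) (trans (even≡not-even-suc (suc (p + j))) (cong not (∧-conicalʳ _ _ a))))
          (∧-zeroʳ _)

  inactive⇒active-next : ∀ {j p} → active j p ≡ false → suc p < n → active (suc j) p ≡ true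
  inactive⇒active-next {j} {p} a 1+p<n = cong₂ _∧_ (<⇒<ᵇ≡true 1+p<n)
    (trans (cong (even ∘ suc) (+-suc p j)) (trans (even≡not-even-suc (p + j)) (cong not odd)))
    where
    odd : even (suc p + j) ≡ false
    odd = trans (cong (_∧ even (suc p + j)) (sym (<⇒<ᵇ≡true 1+p<n))) a

  record CompareExchange (j : ℕ) (y : ℕ → Bool) (s : EdgeSet) : Set where
    field
      selects-active        : ∀ p → s p ≡ true → active j p ≡ true
      swapped-not-ascending : ∀ p → s p ≡ true → y (suc p) ≡ true → y p ≡ true
      kept-not-descending   : ∀ p → active j p ≡ true → s p ≡ false → y p ≡ true → y (suc p) ≡ true

    inactive-unselected : ∀ {p} → active j p ≡ false → s p ≡ false
    inactive-unselected {p} a with s p in sₚ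
    ... | true  = ⊥-elim (true≢false (trans (sym (selects-active p sₚ)) a))
    ... | false = refl

    matching : IsMatching n s
    matching = (λ p sₚ → active⇒edge (selects-active p sₚ))
             , (λ p sₚ → inactive-unselected (active⇒inactive-suc (selects-active p sₚ)))

    exchange-max : ∀ {p} → active j p ≡ true → y (mate s (suc p)) ≡ y p ∨ y (suc p)
    exchange-max {p} a = by-selection (s p) refl
      where
      by-selection : ∀ b → s p ≡ b → y (mate s (suc p)) ≡ y p ∨ y (suc p)
      by-selection true  sₚ = trans (cong y (mate-selected matching sₚ))
                                    (sym ([y⇒x]⇒x∨y≡x (swapped-not-ascending p sₚ)))
      by-selection false sₚ = trans (cong y (mate-free s (inactive-unselected (active⇒inactive-suc a)) sₚ))
                                    (sym ([x⇒y]⇒x∨y≡y (kept-not-descending p a sₚ)))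

    onesFrom-exchange-active : ∀ {p} → active j p ≡ true →
      onesFrom (y ∘ mate s) (suc p) ≡ bit (y p ∨ y (suc p)) + onesFrom y (suc (suc p))
    onesFrom-exchange-active a = trans (onesFrom-unfold (y ∘ mate s) (active⇒edge a))
      (cong₂ _+_ (cong bit (exchange-max a))
                 (onesFrom-swap matching y (inactive-unselected (active⇒inactive-suc a))))

  slack : ℕ → (ℕ → Bool) → ℕ → ℕ
  slack j y zero    = 0
  slack j y (suc p) = bit (y p ∧ active j p)

  -- The slack lets y be one 1 short right of an edge of round j whose left end holds a 1 of y:
  -- the round-j compare-exchange moves that 1 across the edge.
  Lags : ℕ → (ℕ → Bool) → (ℕ → Bool) → Set
  Lags j x y = ∀ q → onesFrom x q ≤ onesFrom y q + slack j y q

  slack-inactive : ∀ {j p} y → active j p ≡ false → slack j y (suc p) ≡ 0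
  slack-inactive {p = p} y a = cong bit (trans (cong (y p ∧_) a) (∧-zeroʳ (y p)))

  slack-active : ∀ {j} y p → active j p ≡ true → slack j y p ≡ 0
  slack-active y zero    _ = refl
  slack-active y (suc p) a = slack-inactive y (active-suc⇒inactive a)

  lags-tight : ∀ {j x y} → Lags j x y → ∀ q → slack j y q ≡ 0 → onesFrom x q ≤ onesFrom y q
  lags-tight lags q tight = ≤-trans (lags q) (≤-reflexive (trans (cong (_ +_) tight) (+-identityʳ _)))

  lags-refl : ∀ {j} x → Lags j x x
  lags-refl x q = m≤m+n _ _

  lags-resp : ∀ {j x x′ y y′} → x ≗ x′ → y ≗ y′ → Lags j x y → Lags j x′ y′
  lags-resp {j} {y = y} {y′} x≗x′ y≗y′ lags q =
    subst₂ _≤_ (onesFrom-cong x≗x′ q) (cong₂ _+_ (onesFrom-cong y≗y′ q) (slack-cong q)) (lags q)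
    where
    slack-cong : ∀ q → slack j y q ≡ slack j y′ q
    slack-cong zero    = refl
    slack-cong (suc p) = cong (λ b → bit (b ∧ active j p)) (y≗y′ p)

  module _ {j x y s} (ce : CompareExchange j y s) (lags : Lags j x y) where
    open CompareExchange ce

    lags-active-edge : ∀ {x′} → MovesAtMostOne x x′ → ∀ {p} → active j p ≡ true →
                       onesFrom x′ (suc p) ≤ onesFrom (y ∘ mate s) (suc p)
    lags-active-edge {x′} moves {p} a =
      ≤-trans (bound (y p) refl) (≤-reflexive (sym (onesFrom-exchange-active a)))
      where
      open MovesAtMostOne moves
      open ≤-Reasoning
      bound : ∀ b → y p ≡ b → onesFrom x′ (suc p) ≤ bit (b ∨ y (suc p)) + onesFrom y (suc (suc p))
      bound true _ = begin
        onesFrom x′ (suc p)             ≤⟨ from-suc (suc p) ⟩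
        suc (onesFrom x (suc (suc p)))  ≤⟨ s≤s (lags-tight lags (suc (suc p)) (slack-inactive y (active⇒inactive-suc a))) ⟩
        suc (onesFrom y (suc (suc p)))  ∎
      bound false yₚ = begin
        onesFrom x′ (suc p)                         ≤⟨ from-pred (suc p) ⟩
        onesFrom x p                                ≤⟨ lags-tight lags p (slack-active y p a) ⟩
        onesFrom y p                                ≡⟨ onesFrom-unfold y (<-trans (n<1+n p) (active⇒edge a)) ⟩
        bit (y p) + onesFrom y (suc p)              ≡⟨ cong (λ b → bit b + onesFrom y (suc p)) yₚ ⟩
        onesFrom y (suc p)                          ≡⟨ onesFrom-unfold y (active⇒edge a) ⟩
        bit (y (suc p)) + onesFrom y (suc (suc p))  ∎

    dominated-after-exchange : ∀ q → onesFrom x q ≤ onesFrom (y ∘ mate s) q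
    dominated-after-exchange zero =
      ≤-trans (lags-tight lags 0 refl) (≤-reflexive (sym (onesFrom-swap matching y tt)))
    dominated-after-exchange (suc p) with active j p in a
    ... | true  = lags-active-edge (moves-refl x) a
    ... | false = ≤-trans (lags-tight lags (suc p) (slack-inactive y a))
                          (≤-reflexive (sym (onesFrom-swap matching y (inactive-unselected a))))

    lags-step : ∀ {x′} → MovesAtMostOne x x′ → Lags (suc j) x′ (y ∘ mate s)
    lags-step moves zero =
      ≤-trans (MovesAtMostOne.from-pred moves 0) (≤-trans (dominated-after-exchange 0) (m≤m+n _ _))
    lags-step {x′} moves (suc p) with active j p in a
    ... | true = ≤-trans (lags-active-edge moves a) (m≤m+n _ _)
    ... | false with suc p <? n
    ...   | no  1+p≮n = ≤-trans (≤-reflexive (onesFrom-beyond x′ (≮⇒≥ 1+p≮n))) z≤n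
    ...   | yes 1+p<n = begin
        onesFrom x′ (suc p)                            ≤⟨ MovesAtMostOne.from-pred moves (suc p) ⟩
        onesFrom x p                                   ≤⟨ dominated-after-exchange p ⟩
        onesFrom y′ p                                  ≡⟨ onesFrom-unfold y′ (<-trans (n<1+n p) 1+p<n) ⟩
        bit (y′ p) + onesFrom y′ (suc p)               ≡⟨ +-comm (bit (y′ p)) _ ⟩
        onesFrom y′ (suc p) + bit (y′ p)               ≡⟨ cong (λ b → onesFrom y′ (suc p) + bit b) (sym y′ₚ∧active) ⟩
        onesFrom y′ (suc p) + slack (suc j) y′ (suc p) ∎
      where
      open ≤-Reasoning
      y′ : ℕ → Bool
      y′ = y ∘ mate s
      y′ₚ∧active : y′ p ∧ active (suc j) p ≡ y′ p
      y′ₚ∧active = trans (cong (y′ p ∧_) (inactive⇒active-next a 1+p<n)) (∧-identityʳ _)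

  -- Threshold words of configurations

  above : Config n → ℕ → ℕ → Bool
  above g θ i with i <? n
  ... | yes i<n = θ ≤ᵇ toℕ (g (fromℕ< i<n))
  ... | no  _   = false

  above-< : ∀ g θ {i} (i<n : i < n) → above g θ i ≡ (θ ≤ᵇ toℕ (g (fromℕ< i<n)))
  above-< g θ {i} i<n with i <? n
  ... | yes _   = refl
  ... | no  i≮n = ⊥-elim (i≮n i<n)

  above-≮ : ∀ g θ {i} → ¬ i < n → above g θ i ≡ false
  above-≮ g θ {i} i≮n with i <? n
  ... | yes i<n = ⊥-elim (i≮n i<n)
  ... | no  _   = refl

  above-toℕ : ∀ g θ u → above g θ (toℕ u) ≡ (θ ≤ᵇ toℕ (g u))
  above-toℕ g θ u = trans (above-< g θ (toℕ<n u)) (cong (λ v → θ ≤ᵇ toℕ (g v)) (fromℕ<-toℕ u (toℕ<n u)))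

  above-id : ∀ {g} → IsId g → ∀ θ {i} → i < n → above g θ i ≡ (θ ≤ᵇ i)
  above-id {g} id θ i<n = trans (above-< g θ i<n) (cong (θ ≤ᵇ_) (trans (cong toℕ (id _)) (toℕ-fromℕ< i<n)))

  isId-from-above : ∀ g → (∀ θ {i} → i < n → above g θ i ≡ (θ ≤ᵇ i)) → IsId g
  isId-from-above g sorted u =
    toℕ-injective (≤ᵇ-injective λ θ → trans (sym (above-toℕ g θ u)) (sorted θ (toℕ<n u)))

  toℕ-partner : ∀ {s} → IsMatching n s → (u : Fin n) → toℕ (partner s u) ≡ mate s (toℕ u)
  toℕ-partner {s} M u with s (toℕ u) in sᵤ | suc (toℕ u) <? n
  ... | true  | yes 1+u<n = trans (toℕ-fromℕ< 1+u<n) (sym (mate-right s sᵤ))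
  ... | true  | no  1+u≮n = ⊥-elim (1+u≮n (proj₁ M _ sᵤ))
  toℕ-partner {s} M Fin.zero    | false | _ = sym (mate-free s sᵤ tt)
  toℕ-partner {s} M (Fin.suc k) | false | _ with s (toℕ k) in sₖ
  ... | true  rewrite sᵤ = toℕ-inject₁ k
  ... | false rewrite sᵤ = refl

  above-swap : ∀ {s} → IsMatching n s → ∀ g θ i → above (g ⟪ s ⟫) θ i ≡ above g θ (mate s i)
  above-swap {s} M g θ i with i <? n
  ... | yes i<n = begin
      θ ≤ᵇ toℕ (g (partner s u))     ≡⟨ sym (above-toℕ g θ (partner s u)) ⟩
      above g θ (toℕ (partner s u))  ≡⟨ cong (above g θ) (toℕ-partner M u) ⟩
      above g θ (mate s (toℕ u))     ≡⟨ cong (above g θ ∘ mate s) (toℕ-fromℕ< i<n) ⟩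
      above g θ (mate s i)           ∎
    where
    open ≡-Reasoning
    u : Fin n
    u = fromℕ< i<n
  ... | no  i≮n = sym (trans (cong (above g θ) (mate-beyond M (≮⇒≥ i≮n))) (above-≮ g θ i≮n))

  onesFrom-above-swap : ∀ {s} → IsMatching n s → ∀ g θ → onesFrom (above (g ⟪ s ⟫) θ) 0 ≡ onesFrom (above g θ) 0
  onesFrom-above-swap M g θ = trans (onesFrom-cong (above-swap M g θ) 0) (onesFrom-swap M (above g θ) tt)

  selectAP-< : ∀ h j {p} (1+p<n : suc p < n) →
    selectAP {n} h j p ≡ (toℕ (h (fromℕ< 1+p<n)) <ᵇ toℕ (h (fromℕ< (<-trans (n<1+n p) 1+p<n)))) ∧ even (suc p + j)
  selectAP-< h j {p} 1+p<n with suc p <? n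
  ... | yes _      = refl
  ... | no  1+p≮n  = ⊥-elim (1+p≮n 1+p<n)

  selectAP-edge : ∀ h j {p} → selectAP {n} h j p ≡ true → suc p < n
  selectAP-edge h j {p} selected with suc p <? n
  ... | yes 1+p<n = 1+p<n
  ... | no  _     = ⊥-elim (true≢false (sym selected))

  selectAP-compareExchange : ∀ h j θ → CompareExchange j (above h θ) (selectAP {n} h j)
  selectAP-compareExchange h j θ = record
    { selects-active        = selects-active
    ; swapped-not-ascending = swapped-not-ascending
    ; kept-not-descending   = kept-not-descending
    }
    where
    selects-active : ∀ p → selectAP {n} h j p ≡ true → active j p ≡ true
    selects-active p selected = cong₂ _∧_ (<⇒<ᵇ≡true 1+p<n)
      (∧-conicalʳ _ _ (trans (sym (selectAP-< h j 1+p<n)) selected))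
      where
      1+p<n : suc p < n
      1+p<n = selectAP-edge h j selected

    swapped-not-ascending : ∀ p → selectAP {n} h j p ≡ true → above h θ (suc p) ≡ true → above h θ p ≡ true
    swapped-not-ascending p selected above₊ =
      trans (above-< h θ p<n) (≤⇒≤ᵇ≡true (≤-trans θ≤right (<⇒≤ descent)))
      where
      1+p<n : suc p < n
      1+p<n = selectAP-edge h j selected
      p<n : p < n
      p<n = <-trans (n<1+n p) 1+p<n
      descent : toℕ (h (fromℕ< 1+p<n)) < toℕ (h (fromℕ< p<n))
      descent = <ᵇ≡true⇒< (∧-conicalˡ _ _ (trans (sym (selectAP-< h j 1+p<n)) selected))
      θ≤right : θ ≤ toℕ (h (fromℕ< 1+p<n))
      θ≤right = ≤ᵇ≡true⇒≤ (trans (sym (above-< h θ 1+p<n)) above₊)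

    kept-not-descending : ∀ p → active j p ≡ true → selectAP {n} h j p ≡ false →
                          above h θ p ≡ true → above h θ (suc p) ≡ true
    kept-not-descending p a kept aboveₚ =
      trans (above-< h θ 1+p<n) (≤⇒≤ᵇ≡true (≤-trans θ≤left ascent))
      where
      1+p<n : suc p < n
      1+p<n = active⇒edge a
      p<n : p < n
      p<n = <-trans (n<1+n p) 1+p<n
      descends : Bool
      descends = toℕ (h (fromℕ< 1+p<n)) <ᵇ toℕ (h (fromℕ< p<n))
      no-descent : descends ≡ false
      no-descent = trans (sym (∧-identityʳ descends))
        (subst (λ b → descends ∧ b ≡ false) (∧-conicalʳ (suc p <ᵇ n) _ a) (trans (sym (selectAP-< h j 1+p<n)) kept))
      ascent : toℕ (h (fromℕ< p<n)) ≤ toℕ (h (fromℕ< 1+p<n))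
      ascent = ≮⇒≥ (λ descent → true≢false (trans (sym (<⇒<ᵇ≡true descent)) no-descent))
      θ≤left : θ ≤ toℕ (h (fromℕ< p<n))
      θ≤left = ≤ᵇ≡true⇒≤ (trans (sym (above-< h θ p<n)) aboveₚ)

  selectAP-matching : ∀ h j → IsMatching n (selectAP {n} h j)
  selectAP-matching h j = CompareExchange.matching (selectAP-compareExchange h j 0)

  onesFrom-above-applyAll : ∀ {ss} → All (IsMatching n) ss → ∀ g θ →
                            onesFrom (above (applyAll g ss) θ) 0 ≡ onesFrom (above g θ) 0
  onesFrom-above-applyAll []       g θ = refl
  onesFrom-above-applyAll {s ∷ _} (M ∷ Ms) g θ =
    trans (onesFrom-above-applyAll Ms (g ⟪ s ⟫) θ) (onesFrom-above-swap M g θ)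

  onesFrom-above-apConf : ∀ f j θ → onesFrom (above (apConf f j) θ) 0 ≡ onesFrom (above f θ) 0
  onesFrom-above-apConf f zero    θ = refl
  onesFrom-above-apConf f (suc j) θ =
    trans (onesFrom-above-swap (selectAP-matching (apConf f j) (suc j)) (apConf f j) θ)
          (onesFrom-above-apConf f j θ)

  lags-round : ∀ {s} → IsMatching n s → ∀ f g t θ →
    Lags (suc t) (above g θ) (above (apConf f t) θ) →
    Lags (suc (suc t)) (above (g ⟪ s ⟫) θ) (above (apConf f (suc t)) θ)
  lags-round M f g t θ lags =
    lags-resp (λ i → sym (above-swap M g θ i)) (λ i → sym (above-swap (selectAP-matching h (suc t)) h θ i))
              (lags-step ce lags (moves-swap M (above g θ)))
    where
    h : Config n
    h = apConf f t
    ce : CompareExchange (suc t) (above h θ) (selectAP {n} h (suc t))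
    ce = selectAP-compareExchange h (suc t) θ

  lags-run : ∀ f θ {ss} → All (IsMatching n) ss → ∀ g t →
    Lags (suc t) (above g θ) (above (apConf f t) θ) →
    Lags (suc (t + length ss)) (above (applyAll g ss) θ) (above (apConf f (t + length ss)) θ)
  lags-run f θ []                g t lags rewrite +-identityʳ t = lags
  lags-run f θ {s ∷ ss} (M ∷ Ms) g t lags rewrite +-suc t (length ss) =
    lags-run f θ Ms (g ⟪ s ⟫) (suc t) (lags-round M f g t θ lags)

  apConf-isId-after : ∀ f ss → All (IsMatching n) ss → IsId (applyAll f ss) → IsId (apConf f (suc (length ss)))
  apConf-isId-after f ss Ms sorted = isId-from-above (apConf f (suc R)) λ θ i<n →
    trans (dominated-sorted-word θ (above-id sorted θ) (dominated θ) (total θ) i<n) (above-id sorted θ i<n)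
    where
    R : ℕ
    R = length ss
    dominated : ∀ θ q → onesFrom (above (applyAll f ss) θ) q ≤ onesFrom (above (apConf f (suc R)) θ) q
    dominated θ q = ≤-trans (dominated-after-exchange ce (lags-run f θ Ms f 0 (lags-refl _)) q)
                            (≤-reflexive (sym (onesFrom-cong (above-swap (selectAP-matching h (suc R)) h θ) q)))
      where
      h : Config n
      h = apConf f R
      ce : CompareExchange (suc R) (above h θ) (selectAP {n} h (suc R))
      ce = selectAP-compareExchange h (suc R) θ
    total : ∀ θ → onesFrom (above (apConf f (suc R)) θ) 0 ≡ onesFrom (above (applyAll f ss) θ) 0
    total θ = trans (onesFrom-above-apConf f (suc R) θ) (sym (onesFrom-above-applyAll Ms f θ))

isId? : ∀ {n} (g : Config n) → Dec (IsId g)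
isId? g = all? (λ u → g u ≟ᶠ u)

theorem7 : (n : ℕ) (f : Config n) → IsConfig f →
           (r : ℕ) → IsRt f r →
           ∃ λ L → APLength f L × L ≤ r + 1
theorem7 n f _ r ((ss , refl , matchings , sorts) , _)
  with least-≤ (λ j → isId? (apConf f j)) (suc (length ss)) (apConf-isId-after n f ss matchings sorts)
... | L , halts , L≤1+r = L , halts , ≤-trans L≤1+r (≤-reflexive (+-comm 1 (length ss)))
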